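{- The Butterfly graph, consisting of two triangles sharing exactly one common vertex (5 vertices, 6 links), is not separable.
   Context: A graph $G=(V,E)$ is separable if there exist non-negative real weights $w(e)$, $e\in E$, and a threshold $\alpha\in\mathbb{R}$ such that for every $E'\subseteq E$: $\sum_{e\in E'}w(e)\ge\alpha$ if and only if the spanning subgraph $(V,E')$ is connected. -}

module Defs where

open import Level using (0ℓ)
open import Data.Bool using (Bool; true; false; if_then_else_)
open import Data.Nat using (ℕ)
open import Data.Fin using (Fin; zero; suc)
open import Data.Fin.Subset using (Subset; _∈_)
open import Data.Vec using (Vec; []; _∷_)
open import Data.Product using (Σ; ∃; _×_; _,_)
open import Data.Sum using (_⊎_)
open import Function using (_∘_)
open import Function.Bundles using (_⇔_)
open import Relation.Nullary using (¬_)
open import Relation.Binary.PropositionalEquality using (_≡_)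
open import Relation.Binary.Structures using (IsTotalOrder)
open import Algebra.Bundles using (CommutativeRing)

-- The real numbers, axiomatised as a Dedekind-complete ordered field.
-- (agda-stdlib has no reals; any such structure is isomorphic to ℝ.)

record RealField : Set₁ where
  field
    commRing : CommutativeRing 0ℓ 0ℓ
  open CommutativeRing commRing public
  field
    _≤_        : Carrier → Carrier → Set
    isTotalOrder : IsTotalOrder _≈_ _≤_
    +-mono-≤   : ∀ {x y} z → x ≤ y → (x + z) ≤ (y + z)
    *-nonneg   : ∀ {x y} → 0# ≤ x → 0# ≤ y → 0# ≤ (x * y)
    0≉1        : ¬ (0# ≈ 1#)
    inverse    : ∀ x → ¬ (x ≈ 0#) → ∃ λ y → (x * y) ≈ 1#
    complete   : (P : Carrier → Set) → ∃ P →
                 (∃ λ b → ∀ x → P x → x ≤ b) →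
                 ∃ λ s → (∀ x → P x → x ≤ s) ×
                         (∀ b → (∀ x → P x → x ≤ b) → s ≤ b)

record Graph : Set where
  field
    nV   : ℕ
    nE   : ℕ
    ends : Fin nE → Fin nV × Fin nV

open Graph public

Joins : (G : Graph) → Fin (nE G) → Fin (nV G) → Fin (nV G) → Set
Joins G e u v with ends G e
... | a , b = (a ≡ u × b ≡ v) ⊎ (a ≡ v × b ≡ u)

data Reach (G : Graph) (E' : Subset (nE G)) : Fin (nV G) → Fin (nV G) → Set where
  here : ∀ {u} → Reach G E' u u
  step : ∀ {u x v} (e : Fin (nE G)) → e ∈ E' → Joins G e u x →
         Reach G E' x v → Reach G E' u v

Connected : (G : Graph) → Subset (nE G) → Set
Connected G E' = ∀ u v → Reach G E' u v

module _ (R : RealField) where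
  open RealField R using (Carrier; 0#; _+_; _≤_)

  subsetSum : ∀ {m} → (Fin m → Carrier) → Subset m → Carrier
  subsetSum w []      = 0#
  subsetSum w (b ∷ s) = (if b then w zero else 0#) + subsetSum (w ∘ suc) s

  Separable : Graph → Set
  Separable G =
    Σ (Fin (nE G) → Carrier) λ w →
    (∀ e → 0# ≤ w e) ×
    Σ Carrier λ α →
    ∀ (E' : Subset (nE G)) → (α ≤ subsetSum w E') ⇔ Connected G E'

-- Butterfly graph: triangles {0,1,2} and {0,3,4} sharing vertex 0.

butterflyEnds : Fin 6 → Fin 5 × Fin 5
butterflyEnds zero                               = zero , suc zero
butterflyEnds (suc zero)                         = suc zero , suc (suc zero)
butterflyEnds (suc (suc zero))                   = suc (suc zero) , zero
butterflyEnds (suc (suc (suc zero)))             = zero , suc (suc (suc zero))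
butterflyEnds (suc (suc (suc (suc zero))))       = suc (suc (suc zero)) , suc (suc (suc (suc zero)))
butterflyEnds (suc (suc (suc (suc (suc zero))))) = suc (suc (suc (suc zero))) , zero

Butterfly : Graph
Butterfly = record { nV = 5 ; nE = 6 ; ends = butterflyEnds }

{-# OPTIONS --safe #-}
module Submission where

-- The edge sets T₁ = {01,12,03,34} and T₂ = {01,20,03,40} are spanning trees,
-- while D₁ = {01,12,20,03} isolates vertex 4 and D₂ = {01,03,34,40} isolates
-- vertex 2.  Both pairs have union E and intersection {01,03}, so by the
-- modular law for subset sums w(T₁) + w(T₂) = w(D₁) + w(D₂).  A threshold α
-- with α ≤ w(T₁), α ≤ w(T₂) and w(D₂) < α then forces α ≤ w(D₁), i.e. D₁ would
-- have to be connected.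

open import Defs
open import Data.Bool using (Bool; true; false; _∨_; _∧_; if_then_else_)
open import Data.Fin using (Fin; zero; suc; _≟_)
open import Data.Fin.Properties using (all?)
open import Data.Fin.Subset using (Subset; _∈_; _∪_; _∩_)
open import Data.Fin.Subset.Properties using (_∈?_)
open import Data.Vec using ([]; _∷_)
open import Data.Product using (_×_; _,_; proj₁; proj₂)
open import Data.Sum using (_⊎_; inj₁; inj₂; [_,_])
open import Data.Empty using (⊥-elim)
open import Data.Unit using (tt)
open import Function using (_∘_; _∘′_)
open import Function.Bundles using (Equivalence)
open import Relation.Nullary using (¬_; Dec; ¬?; _×-dec_; _→-dec_; contradiction)
open import Relation.Nullary.Decidable using (True; toWitness)
open import Relation.Binary.PropositionalEquality using (_≡_; _≢_; refl)
open import Relation.Binary.Structures using (IsTotalOrder)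
open import Relation.Binary.Bundles using (Preorder)
import Algebra.Properties.CommutativeSemigroup as CommutativeSemigroupProperties

module _ {G : Graph} where

  Joins-sym : ∀ {e u v} → Joins G e u v → Joins G e v u
  Joins-sym {e} j with ends G e
  Joins-sym (inj₁ (p , q)) | _ , _ = inj₂ (p , q)
  Joins-sym (inj₂ (p , q)) | _ , _ = inj₁ (p , q)

  Joins⇒endpoint : ∀ {e u v} → Joins G e u v →
                   proj₁ (ends G e) ≡ u ⊎ proj₂ (ends G e) ≡ u
  Joins⇒endpoint {e} j with ends G e
  Joins⇒endpoint (inj₁ (p , _)) | _ , _ = inj₁ p
  Joins⇒endpoint (inj₂ (_ , q)) | _ , _ = inj₂ q

  module _ {E' : Subset (nE G)} where

    Reach-trans : ∀ {u v x} → Reach G E' u v → Reach G E' v x → Reach G E' u x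
    Reach-trans here          q = q
    Reach-trans (step e m j p) q = step e m j (Reach-trans p q)

    Reach-sym : ∀ {u v} → Reach G E' u v → Reach G E' v u
    Reach-sym here           = here
    Reach-sym (step e m j p) = Reach-trans (Reach-sym p) (step e m (Joins-sym j) here)

    step′ : ∀ {u x v} e {e∈E' : True (e ∈? E')} → Joins G e u x → Reach G E' x v → Reach G E' u v
    step′ e {e∈E'} = step e (toWitness e∈E')

    connected-via : (c : Fin (nV G)) → (∀ u → Reach G E' u c) → Connected G E'
    connected-via c toC u v = Reach-trans (toC u) (Reach-sym (toC v))

Isolated : (G : Graph) → Subset (nE G) → Fin (nV G) → Set
Isolated G E' u = ∀ e → e ∈ E' → proj₁ (ends G e) ≢ u × proj₂ (ends G e) ≢ u

isolated? : (G : Graph) (E' : Subset (nE G)) (u : Fin (nV G)) → Dec (Isolated G E' u)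
isolated? G E' u = all? λ e →
  (e ∈? E') →-dec (¬? (proj₁ (ends G e) ≟ u) ×-dec ¬? (proj₂ (ends G e) ≟ u))

module _ {G : Graph} {E' : Subset (nE G)} {u : Fin (nV G)} (iso : Isolated G E' u) where

  Isolated⇒Reach-trivial : ∀ {v} → Reach G E' u v → u ≡ v
  Isolated⇒Reach-trivial here = refl
  Isolated⇒Reach-trivial (step e m j _) =
    ⊥-elim ([ proj₁ (iso e m) , proj₂ (iso e m) ] (Joins⇒endpoint {G = G} j))

  Isolated⇒disconnected : ∀ {v} → u ≢ v → ¬ Connected G E'
  Isolated⇒disconnected u≢v conn = u≢v (Isolated⇒Reach-trivial (conn u _))

module _ (R : RealField) where
  open RealField R
    using ( Carrier; 0#; _+_; -_; _≈_; _≤_; +-comm; +-cong; +-congˡ; +-assoc; +-identityʳ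
          ; -‿inverseʳ; +-mono-≤; setoid; +-commutativeSemigroup; isTotalOrder )
    renaming (refl to ≈-refl; sym to ≈-sym; trans to ≈-trans)
  open IsTotalOrder isTotalOrder
    using (total; isPreorder) renaming (trans to ≤-trans; reflexive to ≤-reflexive)
  open CommutativeSemigroupProperties +-commutativeSemigroup using (interchange)

  private
    S : ∀ {m} → (Fin m → Carrier) → Subset m → Carrier
    S = subsetSum R

    ≤-preorder : Preorder _ _ _
    ≤-preorder = record { isPreorder = isPreorder }

    indicator : Carrier → Bool → Carrier
    indicator x b = if b then x else 0#

  indicator-∨-∧ : ∀ x b c →
    indicator x b + indicator x c ≈ indicator x (b ∨ c) + indicator x (b ∧ c)
  indicator-∨-∧ x false c     = +-comm 0# (indicator x c)
  indicator-∨-∧ x true  false = ≈-refl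
  indicator-∨-∧ x true  true  = ≈-refl

  subsetSum-∪-∩ : ∀ {m} (w : Fin m → Carrier) (A B : Subset m) →
                  S w A + S w B ≈ S w (A ∪ B) + S w (A ∩ B)
  subsetSum-∪-∩ w []      []      = ≈-refl
  subsetSum-∪-∩ w (b ∷ A) (c ∷ B) = begin
    (indicator (w zero) b + S (w ∘′ suc) A) + (indicator (w zero) c + S (w ∘′ suc) B)
      ≈⟨ interchange _ _ _ _ ⟩
    (indicator (w zero) b + indicator (w zero) c) + (S (w ∘′ suc) A + S (w ∘′ suc) B)
      ≈⟨ +-cong (indicator-∨-∧ (w zero) b c) (subsetSum-∪-∩ (w ∘′ suc) A B) ⟩
    (indicator (w zero) (b ∨ c) + indicator (w zero) (b ∧ c))
      + (S (w ∘′ suc) (A ∪ B) + S (w ∘′ suc) (A ∩ B))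
      ≈⟨ interchange _ _ _ _ ⟩
    S w ((b ∷ A) ∪ (c ∷ B)) + S w ((b ∷ A) ∩ (c ∷ B)) ∎
    where
    open import Relation.Binary.Reasoning.Setoid setoid

  +-monoʳ-≤ : ∀ z {x y} → x ≤ y → (z + x) ≤ (z + y)
  +-monoʳ-≤ z {x} {y} x≤y =
    ≤-trans (≤-reflexive (+-comm z x)) (≤-trans (+-mono-≤ z x≤y) (≤-reflexive (+-comm y z)))

  +-mono-≤₂ : ∀ {a b c d} → a ≤ b → c ≤ d → (a + c) ≤ (b + d)
  +-mono-≤₂ {b = b} {c} a≤b c≤d = ≤-trans (+-mono-≤ c a≤b) (+-monoʳ-≤ b c≤d)

  +-cancelʳ-≤ : ∀ z {x y} → (x + z) ≤ (y + z) → x ≤ y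
  +-cancelʳ-≤ z {x} {y} le =
    ≤-trans (≤-reflexive (≈-sym (cancel x))) (≤-trans (+-mono-≤ (- z) le) (≤-reflexive (cancel y)))
    where
    cancel : ∀ t → (t + z) + - z ≈ t
    cancel t = ≈-trans (+-assoc t z (- z)) (≈-trans (+-congˡ (-‿inverseʳ z)) (+-identityʳ t))

  ≰⇒≥ : ∀ {x y} → ¬ (x ≤ y) → y ≤ x
  ≰⇒≥ {x} {y} x≰y with total x y
  ... | inj₁ x≤y = contradiction x≤y x≰y
  ... | inj₂ y≤x = y≤x

  threshold-exchange : ∀ {α x y z u} → α ≤ x → α ≤ y → x + y ≈ z + u → ¬ (α ≤ u) → α ≤ z
  threshold-exchange {α} {x} {y} {z} {u} α≤x α≤y x+y≈z+u α≰u = +-cancelʳ-≤ α (begin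
    α + α  ≲⟨ +-mono-≤₂ α≤x α≤y ⟩
    x + y  ≈⟨ x+y≈z+u ⟩
    z + u  ≲⟨ +-monoʳ-≤ z (≰⇒≥ α≰u) ⟩
    z + α  ∎)
    where open import Relation.Binary.Reasoning.Preorder ≤-preorder

pattern v₀ = zero
pattern v₁ = suc zero
pattern v₂ = suc (suc zero)
pattern v₃ = suc (suc (suc zero))
pattern v₄ = suc (suc (suc (suc zero)))

pattern e₀₁ = zero
pattern e₁₂ = suc zero
pattern e₂₀ = suc (suc zero)
pattern e₀₃ = suc (suc (suc zero))
pattern e₃₄ = suc (suc (suc (suc zero)))
pattern e₄₀ = suc (suc (suc (suc (suc zero))))

T₁ T₂ D₁ D₂ : Subset 6
T₁ = true ∷ true  ∷ false ∷ true ∷ true  ∷ false ∷ []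
T₂ = true ∷ false ∷ true  ∷ true ∷ false ∷ true  ∷ []
D₁ = true ∷ true  ∷ true  ∷ true ∷ false ∷ false ∷ []
D₂ = true ∷ false ∷ false ∷ true ∷ true  ∷ true  ∷ []

T₁-connected : Connected Butterfly T₁
T₁-connected = connected-via v₀ λ where
  v₀ → here
  v₁ → step′ e₀₁ (inj₂ (refl , refl)) here
  v₂ → step′ e₁₂ (inj₂ (refl , refl)) (step′ e₀₁ (inj₂ (refl , refl)) here)
  v₃ → step′ e₀₃ (inj₂ (refl , refl)) here
  v₄ → step′ e₃₄ (inj₂ (refl , refl)) (step′ e₀₃ (inj₂ (refl , refl)) here)

T₂-connected : Connected Butterfly T₂
T₂-connected = connected-via v₀ λ where
  v₀ → here
  v₁ → step′ e₀₁ (inj₂ (refl , refl)) here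
  v₂ → step′ e₂₀ (inj₁ (refl , refl)) here
  v₃ → step′ e₀₃ (inj₂ (refl , refl)) here
  v₄ → step′ e₄₀ (inj₁ (refl , refl)) here

D₁-disconnected : ¬ Connected Butterfly D₁
D₁-disconnected = Isolated⇒disconnected (toWitness {a? = isolated? Butterfly D₁ v₄} tt) {v₀} λ ()

D₂-disconnected : ¬ Connected Butterfly D₂
D₂-disconnected = Isolated⇒disconnected (toWitness {a? = isolated? Butterfly D₂ v₂} tt) {v₀} λ ()

lemma5 : (R : RealField) → ¬ Separable R Butterfly
lemma5 R (w , _ , α , separates) = D₁-disconnected (Equivalence.to (separates D₁)
  (threshold-exchange R
    (Equivalence.from (separates T₁) T₁-connected)
    (Equivalence.from (separates T₂) T₂-connected)
    (≈-trans (subsetSum-∪-∩ R w T₁ T₂) (≈-sym (subsetSum-∪-∩ R w D₁ D₂)))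
    (D₂-disconnected ∘ Equivalence.to (separates D₂))))
  where open RealField R using () renaming (sym to ≈-sym; trans to ≈-trans)
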